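{- Let $\mathcal{T}$ be a complete context tree over the alphabet $A=\{a_1,\dots,a_n\}$. Then $\mathcal{T}$ has perfect memory if and only if for every $i\in\{1,\dots,n\}$ we have $\mathcal{T}_i\subseteq\mathcal{T}$.
   Context: Fix a finite alphabet $A=\{a_1,\dots,a_n\}$. A string is a finite sequence of letters of $A$ (possibly empty); $\overline{uv}$ denotes the concatenation of strings $u$ and $v$. A string $v$ is a postfix of $s$, written $v\prec s$, if $s=\overline{wv}$ for some string $w$. A context tree over $A$ is a finite rooted tree in which every vertex other than the root is labeled by a letter of $A$, with no two siblings carrying the same label. A context is the string read along the path from a leaf to the root (the leaf's label first, the label of the root's child last); $\mathcal{T}^*$ denotes the set of contexts of $\mathcal{T}$. $\mathcal{T}$ is complete if every node is either a leaf or has exactly $n$ children. For context trees $\mathcal{A},\mathcal{B}$, write $\mathcal{A}\subseteq\mathcal{B}$ ("contained at the root") if for every $a\in\mathcal{A}^*$ there is $b\in\mathcal{B}^*$ with $a\prec b$ (vacuously true if $\mathcal{A}$ is empty). A context tree $\mathcal{T}$ has perfect memory if for every $c\in\mathcal{T}^*$ and every $i\in\{1,\dots,n\}$ there exists $u\in\mathcal{T}^*$ with $u\prec\overline{ca_i}$. For $i\in\{1,\dots,n\}$, $\mathcal{T}_i$ denotes the subtree of $\mathcal{T}$ rooted at the child of the root labeled $a_i$, viewed as a context tree; its set of contexts is $\mathcal{T}_i^*=\{u \text{ nonempty}: \overline{ua_i}\in\mathcal{T}^*\}$, and $\mathcal{T}_i$ is empty if the root has no child labeled $a_i$ or that child is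 a leaf. -}

module Defs where

open import Data.Nat using (ℕ)
open import Data.Fin using (Fin)
open import Data.Maybe using (Maybe; just; nothing)
open import Data.List using (List; []; _∷_; _++_; [_])
open import Data.Product using (Σ; ∃; _×_)
open import Relation.Binary.PropositionalEquality using (_≡_; _≢_)

-- Alphabet A = {a_1,…,a_n} is Fin n.  Strings are lists, written left to right.
String : ℕ → Set
String n = List (Fin n)

-- A context tree: every vertex has, for each letter, at most one child with that
-- label (so siblings never share a label).  Inductive, hence finite.
data Tree (n : ℕ) : Set where
  node : (Fin n → Maybe (Tree n)) → Tree n

IsLeaf : ∀ {n} → Tree n → Set
IsLeaf {n} (node ch) = ∀ (a : Fin n) → ch a ≡ nothing

-- Ctx T s : s ∈ T*, the string read from a leaf up to the root
-- (leaf label first, label of the root's child last).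
data Ctx {n : ℕ} : Tree n → String n → Set where
  leaf : ∀ {ch} → IsLeaf (node ch) → Ctx (node ch) []
  step : ∀ {ch a t c} → ch a ≡ just t → Ctx t c → Ctx (node ch) (c ++ [ a ])

data Complete {n : ℕ} : Tree n → Set where
  leafC : ∀ {ch} → IsLeaf (node ch) → Complete (node ch)
  fullC : ∀ {ch} → (∀ (a : Fin n) → Σ (Tree n) λ t → ch a ≡ just t × Complete t)
        → Complete (node ch)

_≺_ : ∀ {n} → String n → String n → Set
_≺_ {n} v s = Σ (String n) λ w → s ≡ w ++ v

PerfectMemory : ∀ {n} → Tree n → Set
PerfectMemory {n} T =
  ∀ (c : String n) → Ctx T c → ∀ (i : Fin n) →
    Σ (String n) λ u → Ctx T u × (u ≺ (c ++ [ i ]))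

-- Contexts of the subtree T_i: T_i* = { u nonempty : u a_i ∈ T* }.
SubCtx : ∀ {n} → Tree n → Fin n → String n → Set
SubCtx T i u = (u ≢ []) × Ctx T (u ++ [ i ])

_⊆ᶜ_ : ∀ {n} → (String n → Set) → Tree n → Set
_⊆ᶜ_ {n} A B = ∀ (a : String n) → A a → Σ (String n) λ b → Ctx B b × (a ≺ b)

module Submission where

open import Defs
open import Data.Nat using (ℕ; zero; suc)
open import Data.Fin using (Fin)
import Data.Fin as Fin
open import Data.List using ([]; _∷_; _++_; [_]; _∷ʳ_; _∷ʳ′_; initLast)
open import Data.List.Properties
  using (++-assoc; ++-identityʳ; ++-identityˡ-unique; ++-conicalˡ; ++-conicalʳ; ∷ʳ-injective)
open import Data.Maybe.Properties using (just-injective)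
open import Data.Product using (Σ; ∃; _×_; _,_; proj₁)
open import Data.Sum using (_⊎_; inj₁; inj₂)
open import Data.Empty using (⊥; ⊥-elim)
open import Function.Base using (_∘_)
open import Function.Bundles using (_⇔_; mk⇔)
open import Relation.Binary.PropositionalEquality
  using (_≡_; _≢_; refl; sym; trans; cong; subst)

-- Contexts of any context tree are postfix-free, and in a complete tree every
-- string s either has a context as a postfix or is a proper postfix of a context
-- (read s from its last letter down the tree until a leaf or the end of s).
-- Given perfect memory and a context a a_i, a context u ≺ a yields a context
-- v ≺ u a_i ≺ a a_i, so v = a a_i by postfix-freeness and hence a ≺ u.
-- Conversely, if c a_i is a proper postfix of a context d c a_i, then d c ∈ T_i*
-- lies below some context b; postfix-freeness forces c = b, so d c ≺ c and d = [].

private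
  variable
    n : ℕ

≺-trans : {u v s : String n} → u ≺ v → v ≺ s → u ≺ s
≺-trans {u = u} (w , refl) (w′ , refl) = w′ ++ w , sym (++-assoc w′ w u)

[]-≺ : (s : String n) → [] ≺ s
[]-≺ s = s , sym (++-identityʳ s)

≺-∷ʳ⁺ : {u s : String n} (a : Fin n) → u ≺ s → (u ∷ʳ a) ≺ (s ∷ʳ a)
≺-∷ʳ⁺ {u = u} a (w , refl) = w , ++-assoc w u [ a ]

≺-∷ʳ⁻ : {u s : String n} {a b : Fin n} → (u ∷ʳ a) ≺ (s ∷ʳ b) → u ≺ s × a ≡ b
≺-∷ʳ⁻ {u = u} {s} {a} (w , eq) with ∷ʳ-injective s (w ++ u) (trans eq (sym (++-assoc w u [ a ])))
... | s≡wu , b≡a = (w , s≡wu) , sym b≡a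

∷ʳ-⊀-[] : {u : String n} {a : Fin n} → (u ∷ʳ a) ≺ [] → ⊥
∷ʳ-⊀-[] {u = u} {a} (w , eq) with ++-conicalʳ u [ a ] (++-conicalʳ w (u ∷ʳ a) (sym eq))
... | ()

++-≺⇒≡[] : (d : String n) {s : String n} → (d ++ s) ≺ s → d ≡ []
++-≺⇒≡[] d {s} (w , eq) =
  ++-conicalʳ w d (++-identityˡ-unique (w ++ d) (trans eq (sym (++-assoc w d s))))

ctx-postfixFree : {T : Tree n} {v s : String n} → Ctx T v → Ctx T s → v ≺ s → v ≡ s
ctx-postfixFree (leaf _) (leaf _) _ = refl
ctx-postfixFree (leaf isLeaf) (step e _) _ with trans (sym (isLeaf _)) e
... | ()
ctx-postfixFree (step _ _) (leaf _) v≺[] = ⊥-elim (∷ʳ-⊀-[] v≺[])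
ctx-postfixFree (step e cv) (step e′ cs) p with ≺-∷ʳ⁻ p
... | v≺s , refl with just-injective (trans (sym e) e′)
... | refl = cong (_∷ʳ _) (ctx-postfixFree cv cs v≺s)

complete⇒∃ctx : {T : Tree n} → Complete T → ∃ (Ctx T)
complete⇒∃ctx         (leafC isLeaf) = [] , leaf isLeaf
complete⇒∃ctx {zero}  (fullC _)      = [] , leaf λ ()
complete⇒∃ctx {suc _} (fullC children) with children Fin.zero
... | _ , e , complete with complete⇒∃ctx complete
... | c , cc = c ∷ʳ Fin.zero , step e cc

HasContextPostfix : Tree n → String n → Set
HasContextPostfix {n} T s = Σ (String n) λ u → Ctx T u × (u ≺ s)

IsProperContextPostfix : Tree n → String n → Set
IsProperContextPostfix {n} T s = Σ (String n) λ d → d ≢ [] × Ctx T (d ++ s)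

complete-parse : {T : Tree n} → Complete T → (s : String n) →
                 HasContextPostfix T s ⊎ IsProperContextPostfix T s
complete-parse complete s with initLast s
complete-parse complete ._ | [] with complete⇒∃ctx complete
... | []    , cc = inj₁ ([] , cc , [] , refl)
... | x ∷ c , cc = inj₂ (x ∷ c , (λ ()) , subst (Ctx _) (sym (++-identityʳ (x ∷ c))) cc)
complete-parse (leafC isLeaf)   ._ | s ∷ʳ′ x = inj₁ ([] , leaf isLeaf , []-≺ (s ∷ʳ x))
complete-parse (fullC children) ._ | s ∷ʳ′ x with children x
... | _ , e , complete with complete-parse complete s
... | inj₁ (u , cu , u≺s)  = inj₁ (u ∷ʳ x , step e cu , ≺-∷ʳ⁺ x u≺s)
... | inj₂ (d , d≢[] , cd) = inj₂ (d , d≢[] , subst (Ctx _) (++-assoc d s [ x ]) (step e cd))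

subCtx-++ : {T : Tree n} {d c : String n} {i : Fin n} →
            d ≢ [] → Ctx T (d ++ (c ∷ʳ i)) → SubCtx T i (d ++ c)
subCtx-++ {d = d} {c} {i} d≢[] cdci =
  d≢[] ∘ ++-conicalˡ d c , subst (Ctx _) (sym (++-assoc d c [ i ])) cdci

perfectMemory⇒subtrees⊆ : {T : Tree n} → Complete T → PerfectMemory T → ∀ i → SubCtx T i ⊆ᶜ T
perfectMemory⇒subtrees⊆ complete pm i a (_ , cai) with complete-parse complete a
... | inj₂ (d , _ , cda) = d ++ a , cda , d , refl
... | inj₁ (u , cu , u≺a) with pm u cu i
... | v , cv , v≺ui with ctx-postfixFree cv cai (≺-trans v≺ui (≺-∷ʳ⁺ i u≺a))
... | refl = u , cu , proj₁ (≺-∷ʳ⁻ v≺ui)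

subtrees⊆⇒perfectMemory : {T : Tree n} → Complete T → (∀ i → SubCtx T i ⊆ᶜ T) → PerfectMemory T
subtrees⊆⇒perfectMemory complete sub⊆ c cc i with complete-parse complete (c ∷ʳ i)
... | inj₁ postfix = postfix
... | inj₂ (d , d≢[] , cdci) with sub⊆ i (d ++ c) (subCtx-++ d≢[] cdci)
... | b , cb , dc≺b with ctx-postfixFree cc cb (≺-trans (d , refl) dc≺b)
... | refl = ⊥-elim (d≢[] (++-≺⇒≡[] d dc≺b))

theorem2 : ∀ (n : ℕ) (T : Tree n) → Complete T →
    (PerfectMemory T ⇔ (∀ (i : Fin n) → SubCtx T i ⊆ᶜ T))
theorem2 _ _ complete =
  mk⇔ (perfectMemory⇒subtrees⊆ complete) (subtrees⊆⇒perfectMemory complete)
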